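{- Let $G$ be a graph with $n$ vertices, maximum degree $\Delta\ge 2$, and girth $g$, where $g$ is odd and $g\ge 5$. If $S$ is a $\frac{g-1}{2}$-distance mutual-visibility set of $G$ and the induced subgraph $G[S]$ contains some edge, then $$|S|\le 2+(\Delta-1)^{(g-1)/2}.$$
   Context: All graphs are finite, simple, undirected and connected. The girth is the length of a shortest cycle. For a graph $G$, a set $S\subseteq V(G)$ and an integer $k\ge 1$, two vertices $x,y$ are $S_k$-visible if there is a shortest $x,y$-path of length at most $k$ none of whose internal vertices lies in $S$. $S$ is a $k$-distance mutual-visibility set if every two vertices of $S$ are $S_k$-visible. -}

module Defs where

open import Data.Nat using (ℕ; zero; suc; _≤_; _<_; _≡ᵇ_)
open import Data.Fin using (Fin)
open import Data.Fin.Subset using (Subset; _∈_; _∉_; ∣_∣; inside; outside)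
open import Data.Vec using (tabulate)
open import Data.List using (List; []; _∷_)
open import Data.List.Relation.Unary.All using (All)
open import Data.List.Relation.Unary.Unique.Propositional using (Unique)
open import Data.Product using (Σ; ∃; ∃-syntax; _×_; _,_)
open import Relation.Nullary using (¬_; Dec; yes; no)
open import Relation.Binary.PropositionalEquality using (_≡_)

record Graph (n : ℕ) : Set₁ where
  field
    Adj      : Fin n → Fin n → Set
    adj?     : ∀ x y → Dec (Adj x y)
    sym      : ∀ {x y} → Adj x y → Adj y x
    irrefl   : ∀ {x} → ¬ Adj x x

module _ {n : ℕ} (G : Graph n) where
  open Graph G

  data Walk : ℕ → Fin n → Fin n → Set where
    []  : ∀ {x} → Walk zero x x
    _∷_ : ∀ {x y z k} → Adj x y → Walk k y z → Walk (suc k) x z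

  initVerts : ∀ {k x y} → Walk k x y → List (Fin n)
  initVerts {x = x} []      = []
  initVerts {x = x} (_ ∷ w) = x ∷ initVerts w

  internal : ∀ {k x y} → Walk k x y → List (Fin n)
  internal []      = []
  internal (_ ∷ w) = initVerts w

  Connected : Set
  Connected = ∀ x y → ∃[ k ] Walk k x y

  Dist : Fin n → Fin n → ℕ → Set
  Dist x y d = Walk d x y × (∀ {k} → Walk k x y → d ≤ k)

  -- A cycle of length k: a closed walk of length k ≥ 3 with no repeated
  -- vertices (apart from start = end).
  HasCycleOfLength : ℕ → Set
  HasCycleOfLength k = 3 ≤ k × ∃[ x ] Σ (Walk k x x) (λ w → Unique (initVerts w))

  Girth : ℕ → Set
  Girth g = HasCycleOfLength g × (∀ k → HasCycleOfLength k → g ≤ k)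

  neighbourhood : Fin n → Subset n
  neighbourhood v = tabulate (λ u → decide (adj? v u))
    where
    decide : ∀ {P : Set} → Dec P → _
    decide (yes _) = inside
    decide (no _)  = outside

  degree : Fin n → ℕ
  degree v = ∣ neighbourhood v ∣

  MaxDegree : ℕ → Set
  MaxDegree Δ = (∀ v → degree v ≤ Δ) × ∃[ v ] degree v ≡ Δ

  Visible : Subset n → ℕ → Fin n → Fin n → Set
  Visible S k x y =
    ∃[ d ] d ≤ k × Dist x y d × Σ (Walk d x y) (λ w → All (_∉ S) (internal w))

  DistMutualVisibilitySet : ℕ → Subset n → Set
  DistMutualVisibilitySet k S = ∀ x y → x ∈ S → y ∈ S → Visible S k x y

  InducedHasEdge : Subset n → Set
  InducedHasEdge S = ∃[ x ] ∃[ y ] x ∈ S × y ∈ S × Adj x y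

{-# OPTIONS --safe #-}
-- Let k = (g - 1)/2 and let xy be an edge inside S. Every other s ∈ S is seen from x and
-- from y along shortest paths u and v of length at most k whose inner vertices avoid S.
-- As y ∈ S is neither inside nor at the end of u, u does not start with the edge xy, and
-- likewise v does not start with yx. So the closed walk from s along u reversed, then xy,
-- then v, of length |u| + 1 + |v|, backtracks nowhere except possibly at s; hence it
-- contains a cycle and 2k + 1 ≤ |u| + 1 + k, i.e. |u| = k. Thus s is the end of a
-- non-backtracking walk of length k leaving x but not towards y, and there are at most
-- (Δ - 1)^k such ends.
module Submission where

open import Defs
open import Data.Nat using (ℕ; zero; suc; _≤_; _+_; _*_; _∸_; _^_; _/_; _%_; z≤n; s≤s)
open import Data.Nat.Properties
  using (≤-refl; ≤-reflexive; ≤-trans; ≤-antisym; ≤-pred; n≤1+n; m≤n⇒m≤1+n; m≤n+m; 1+n≰n; +-suc;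
         +-identityʳ; +-mono-≤; +-monoʳ-≤; +-cancelʳ-≤; *-comm; *-monoˡ-≤; ∸-monoˡ-≤; module ≤-Reasoning)
open import Data.Nat.DivMod using (m≡m%n+[m/n]*n; m*n/n≡m)
open import Data.Fin using (Fin; zero; suc; _≟_)
open import Data.Fin.Subset using (Subset; _∈_; _∉_; ∣_∣; inside; outside; _∪_; _-_; ⁅_⁆; ⊥)
open import Data.Fin.Subset.Properties
  using (∣⊥∣≡0; ∣⁅x⁆∣≡1; x∈⁅x⁆; x∈p∪q⁺; p⊆q⇒∣p∣≤∣q∣; p─q⊆p; x∈p∧x≢y⇒x∈p-y; x∈p⇒∣p-x∣<∣p∣)
open import Data.Vec using ([]; _∷_; here; there; lookup)
open import Data.Vec.Properties using (lookup∘tabulate; []=⇒lookup; lookup⇒[]=)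
open import Data.List using (List; []; _∷_; length; map; take; concatMap)
open import Data.List.Properties using (length-map; length-++)
open import Data.List.Membership.Propositional using (lose) renaming (_∈_ to _∈ₗ_)
open import Data.List.Membership.Propositional.Properties using (∈-map⁺; ∈-map⁻; ∈-concatMap⁺)
open import Data.List.Relation.Unary.Any using (here; there; any?)
open import Data.List.Relation.Unary.All as All using (All; []; _∷_)
open import Data.List.Relation.Unary.All.Properties using (¬Any⇒All¬)
open import Data.List.Relation.Unary.AllPairs using ([]; _∷_)
open import Data.List.Relation.Unary.Unique.Propositional using (Unique)
import Data.List.Relation.Unary.Unique.Propositional.Properties as Unique
open import Data.Product using (Σ; ∃-syntax; ∃₂; _×_; _,_; proj₁; proj₂)
open import Data.Sum using (_⊎_; inj₁; inj₂)
open import Function using (_∘_)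
open import Relation.Nullary using (¬_; yes; no; contradiction)
open import Relation.Binary.PropositionalEquality
  using (_≡_; _≢_; refl; sym; trans; cong; subst; module ≡-Reasoning)

variable
  n : ℕ

∣p∪q∣≤∣p∣+∣q∣ : (p q : Subset n) → ∣ p ∪ q ∣ ≤ ∣ p ∣ + ∣ q ∣
∣p∪q∣≤∣p∣+∣q∣ []            []            = z≤n
∣p∪q∣≤∣p∣+∣q∣ (inside ∷ p)  (inside ∷ q)  =
  s≤s (≤-trans (∣p∪q∣≤∣p∣+∣q∣ p q) (+-monoʳ-≤ ∣ p ∣ (n≤1+n ∣ q ∣)))
∣p∪q∣≤∣p∣+∣q∣ (inside ∷ p)  (outside ∷ q) = s≤s (∣p∪q∣≤∣p∣+∣q∣ p q)
∣p∪q∣≤∣p∣+∣q∣ (outside ∷ p) (inside ∷ q)  =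
  ≤-trans (s≤s (∣p∪q∣≤∣p∣+∣q∣ p q)) (≤-reflexive (sym (+-suc ∣ p ∣ ∣ q ∣)))
∣p∪q∣≤∣p∣+∣q∣ (outside ∷ p) (outside ∷ q) = ∣p∪q∣≤∣p∣+∣q∣ p q

fromList : List (Fin n) → Subset n
fromList []       = ⊥
fromList (x ∷ xs) = ⁅ x ⁆ ∪ fromList xs

∣fromList∣≤length : (xs : List (Fin n)) → ∣ fromList xs ∣ ≤ length xs
∣fromList∣≤length {n} []   = ≤-reflexive (∣⊥∣≡0 n)
∣fromList∣≤length (x ∷ xs) = begin
  ∣ ⁅ x ⁆ ∪ fromList xs ∣       ≤⟨ ∣p∪q∣≤∣p∣+∣q∣ ⁅ x ⁆ (fromList xs) ⟩
  ∣ ⁅ x ⁆ ∣ + ∣ fromList xs ∣   ≡⟨ cong (_+ ∣ fromList xs ∣) (∣⁅x⁆∣≡1 x) ⟩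
  suc ∣ fromList xs ∣           ≤⟨ s≤s (∣fromList∣≤length xs) ⟩
  suc (length xs)               ∎
  where open ≤-Reasoning

∈-fromList⁺ : {x : Fin n} {xs : List (Fin n)} → x ∈ₗ xs → x ∈ fromList xs
∈-fromList⁺ {x = x} (here refl) = x∈p∪q⁺ (inj₁ (x∈⁅x⁆ x))
∈-fromList⁺         (there x∈)  = x∈p∪q⁺ (inj₂ (∈-fromList⁺ x∈))

∣p∣≤length : (p : Subset n) (xs : List (Fin n)) → (∀ {x} → x ∈ p → x ∈ₗ xs) → ∣ p ∣ ≤ length xs
∣p∣≤length p xs p⊆xs = ≤-trans (p⊆q⇒∣p∣≤∣q∣ (∈-fromList⁺ ∘ p⊆xs)) (∣fromList∣≤length xs)

toList : Subset n → List (Fin n)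
toList []            = []
toList (inside ∷ p)  = zero ∷ map suc (toList p)
toList (outside ∷ p) = map suc (toList p)

length-toList : (p : Subset n) → length (toList p) ≡ ∣ p ∣
length-toList []            = refl
length-toList (inside ∷ p)  = cong suc (trans (length-map suc (toList p)) (length-toList p))
length-toList (outside ∷ p) = trans (length-map suc (toList p)) (length-toList p)

∈-toList⁺ : {p : Subset n} {x : Fin n} → x ∈ p → x ∈ₗ toList p
∈-toList⁺ {p = inside ∷ p}  here       = here refl
∈-toList⁺ {p = inside ∷ p}  (there x∈) = there (∈-map⁺ suc (∈-toList⁺ x∈))
∈-toList⁺ {p = outside ∷ p} (there x∈) = ∈-map⁺ suc (∈-toList⁺ x∈)

∈-toList⁻ : {p : Subset n} {x : Fin n} → x ∈ₗ toList p → x ∈ p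
∈-toList⁻ {p = inside ∷ p}  (here refl) = here
∈-toList⁻ {p = inside ∷ p}  (there x∈) with ∈-map⁻ suc x∈
... | _ , y∈ , refl = there (∈-toList⁻ y∈)
∈-toList⁻ {p = outside ∷ p} x∈ with ∈-map⁻ suc x∈
... | _ , y∈ , refl = there (∈-toList⁻ y∈)

length-concatMap-≤ : {A B : Set} (f : A → List B) (xs : List A) {m : ℕ} →
                     (∀ {x} → x ∈ₗ xs → length (f x) ≤ m) → length (concatMap f xs) ≤ length xs * m
length-concatMap-≤ f []       _     = z≤n
length-concatMap-≤ f (x ∷ xs) f≤m = ≤-trans (≤-reflexive (length-++ (f x)))
  (+-mono-≤ (f≤m (here refl)) (length-concatMap-≤ f xs (f≤m ∘ there)))

odd⇒≡1+half+half : (g : ℕ) → g % 2 ≡ 1 → g ≡ suc ((g ∸ 1) / 2 + (g ∸ 1) / 2)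
odd⇒≡1+half+half g g-odd = begin
  g                    ≡⟨ g≡1+h*2 ⟩
  suc (h * 2)          ≡⟨ cong suc (*-comm h 2) ⟩
  suc (h + (h + 0))    ≡⟨ cong (λ m → suc (h + m)) (+-identityʳ h) ⟩
  suc (h + h)          ≡⟨ cong (λ m → suc (m + m)) (sym half≡h) ⟩
  suc (half + half)    ∎
  where
  open ≡-Reasoning
  h half : ℕ
  h    = g / 2
  half = (g ∸ 1) / 2
  g≡1+h*2 : g ≡ suc (h * 2)
  g≡1+h*2 = trans (m≡m%n+[m/n]*n g 2) (cong (_+ h * 2) g-odd)
  half≡h : half ≡ h
  half≡h = trans (cong (λ m → (m ∸ 1) / 2) g≡1+h*2) (m*n/n≡m h 2)

module _ (G : Graph n) where
  open Graph G renaming (sym to adj-sym)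

  private variable
    a b c p q s x y z : Fin n
    i j k : ℕ

  vertices : Walk G k a b → List (Fin n)
  vertices {a = a} []      = a ∷ []
  vertices {a = a} (_ ∷ w) = a ∷ vertices w

  end∈vertices : (w : Walk G k a b) → b ∈ₗ vertices w
  end∈vertices []      = here refl
  end∈vertices (_ ∷ w) = there (end∈vertices w)

  _∷ʳ_ : Walk G k a b → Adj b c → Walk G (suc k) a c
  []      ∷ʳ e = e ∷ []
  (d ∷ w) ∷ʳ e = d ∷ (w ∷ʳ e)

  reverse : Walk G k a b → Walk G k b a
  reverse []      = []
  reverse (e ∷ w) = reverse w ∷ʳ adj-sym e

  _++_ : Walk G i a b → Walk G j b c → Walk G (i + j) a c
  []      ++ v = v
  (e ∷ u) ++ v = e ∷ (u ++ v)

  initVerts-∷ʳ : (w : Walk G k a b) (e : Adj b c) → initVerts G (w ∷ʳ e) ≡ vertices w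
  initVerts-∷ʳ []      e = refl
  initVerts-∷ʳ (d ∷ w) e = cong (_ ∷_) (initVerts-∷ʳ w e)

  penultimate : Fin n → Walk G k a b → Fin n
  penultimate p         []      = p
  penultimate {a = a} _ (_ ∷ w) = penultimate a w

  penultimate-∷ʳ : (p : Fin n) (w : Walk G k a b) (e : Adj b c) → penultimate p (w ∷ʳ e) ≡ b
  penultimate-∷ʳ p []      e = refl
  penultimate-∷ʳ p (d ∷ w) e = penultimate-∷ʳ _ w e

  -- The start of the walk counts as entered from p; taking p to be the start itself
  -- makes the first step unconstrained.
  data NonBacktracking : Fin n → Walk G k a b → Set where
    []  : NonBacktracking p ([] {x = a})
    _∷_ : {e : Adj a z} {w : Walk G k z b} → z ≢ p → NonBacktracking a w → NonBacktracking p (e ∷ w)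

  ++-nonBacktracking : (u : Walk G i a b) (v : Walk G j b c) → NonBacktracking p u →
                       NonBacktracking (penultimate p u) v → NonBacktracking p (u ++ v)
  ++-nonBacktracking []      v []          nbv = nbv
  ++-nonBacktracking (e ∷ u) v (z≢p ∷ nbu) nbv = z≢p ∷ ++-nonBacktracking u v nbu nbv

  nonBacktracking-fromMember : {S : Subset n} (w : Walk G k a b) → NonBacktracking p w →
                               All (_∉ S) (internal G w) → q ∈ S → q ≢ b → NonBacktracking q w
  nonBacktracking-fromMember []          []       _         _   _   = []
  nonBacktracking-fromMember (_ ∷ [])    (_ ∷ nb) _         _   q≢b = (q≢b ∘ sym) ∷ nb
  nonBacktracking-fromMember (_ ∷ _ ∷ _) (_ ∷ nb) (z∉S ∷ _) q∈S _   = (λ { refl → z∉S q∈S }) ∷ nb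

  Geodesic : Walk G k a b → Set
  Geodesic {k = k} {a = a} {b = b} _ = ∀ {j} → Walk G j a b → k ≤ j

  reverse-geodesic : (w : Walk G k a b) → Geodesic w → Geodesic (reverse w)
  reverse-geodesic w geo u = geo (reverse u)

  geodesic-tail-nonBacktracking : (e : Adj p a) (w : Walk G k a b) → Geodesic (e ∷ w) →
                                  NonBacktracking p w
  geodesic-tail-nonBacktracking e []      _   = []
  geodesic-tail-nonBacktracking e (d ∷ w) geo =
    (λ { refl → 1+n≰n (≤-trans (n≤1+n _) (geo w)) }) ∷
    geodesic-tail-nonBacktracking d w (λ u → ≤-pred (geo (e ∷ u)))

  geodesic⇒nonBacktracking : (w : Walk G k a b) → Geodesic w → NonBacktracking a w
  geodesic⇒nonBacktracking []      _   = []
  geodesic⇒nonBacktracking (e ∷ w) geo =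
    (λ { refl → irrefl e }) ∷ geodesic-tail-nonBacktracking e w geo

  data _≼_ : Walk G i a b → Walk G j a c → Set where
    []  : {w : Walk G j a c} → [] ≼ w
    _∷_ : (e : Adj a z) {u : Walk G i z b} {w : Walk G j z c} → u ≼ w → (e ∷ u) ≼ (e ∷ w)

  prefixUpTo : (w : Walk G j a c) → b ∈ₗ vertices w → ∃₂ λ i (u : Walk G i a b) → u ≼ w
  prefixUpTo []      (here refl) = 0 , [] , []
  prefixUpTo (e ∷ w) (here refl) = 0 , [] , []
  prefixUpTo (e ∷ w) (there b∈w) with prefixUpTo w b∈w
  ... | i , u , u≼w = suc i , e ∷ u , e ∷ u≼w

  ≼-length : {u : Walk G i a b} {w : Walk G j a c} → u ≼ w → i ≤ j
  ≼-length []        = z≤n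
  ≼-length (_ ∷ u≼w) = s≤s (≼-length u≼w)

  ≼-vertices : {u : Walk G i a b} {w : Walk G j a c} → u ≼ w → vertices u ≡ take (suc i) (vertices w)
  ≼-vertices {w = []}    []        = refl
  ≼-vertices {w = _ ∷ _} []        = refl
  ≼-vertices             (_ ∷ u≼w) = cong (_ ∷_) (≼-vertices u≼w)

  ≼-nonBacktracking : {u : Walk G i a b} {w : Walk G j a c} → u ≼ w →
                      NonBacktracking p w → NonBacktracking p u
  ≼-nonBacktracking []        _          = []
  ≼-nonBacktracking (_ ∷ u≼w) (z≢p ∷ nb) = z≢p ∷ ≼-nonBacktracking u≼w nb

  return-length≥3 : Adj a z → (u : Walk G i z a) → NonBacktracking a u → 3 ≤ suc i
  return-length≥3 e []          _           = contradiction e irrefl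
  return-length≥3 e (_ ∷ [])    (a≢a ∷ _)   = contradiction refl a≢a
  return-length≥3 e (_ ∷ _ ∷ _) _           = s≤s (s≤s (s≤s z≤n))

  -- w is a path, so its segment up to a, closed by e, is a cycle.
  cycleThrough : (e : Adj a z) (w : Walk G j z b) → NonBacktracking a w → Unique (vertices w) →
                 a ∈ₗ vertices w → ∃[ m ] m ≤ suc j × HasCycleOfLength G m
  cycleThrough e w nb uniq a∈w with prefixUpTo w a∈w
  ... | i , u , u≼w = suc i , s≤s (≼-length u≼w) , return-length≥3 e u (≼-nonBacktracking u≼w nb) ,
                      _ , u ∷ʳ e , cycle-unique
    where
    cycle-unique : Unique (initVerts G (u ∷ʳ e))
    cycle-unique = subst Unique (sym (trans (initVerts-∷ʳ u e) (≼-vertices u≼w)))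
                         (Unique.take⁺ (suc i) uniq)

  nonBacktracking⇒path⊎cycle : (w : Walk G k a b) → NonBacktracking p w →
                               Unique (vertices w) ⊎ ∃[ m ] m ≤ k × HasCycleOfLength G m
  nonBacktracking⇒path⊎cycle []      []       = inj₁ ([] ∷ [])
  nonBacktracking⇒path⊎cycle {a = a} (e ∷ w) (_ ∷ nb) with nonBacktracking⇒path⊎cycle w nb
  ... | inj₂ (m , m≤k , cycle) = inj₂ (m , m≤n⇒m≤1+n m≤k , cycle)
  ... | inj₁ uniq with any? (a ≟_) (vertices w)
  ...   | no  a∉w = inj₁ (¬Any⇒All¬ (vertices w) a∉w ∷ uniq)
  ...   | yes a∈w = inj₂ (cycleThrough e w nb uniq a∈w)

  closed⇒¬unique : (w : Walk G k a a) → 1 ≤ k → ¬ Unique (vertices w)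
  closed⇒¬unique (_ ∷ w) _ (a∉w ∷ _) = All.lookup a∉w (end∈vertices w) refl

  girth≤closedNonBacktracking : {g : ℕ} → Girth G g → (w : Walk G k a a) → 1 ≤ k →
                                NonBacktracking p w → g ≤ k
  girth≤closedNonBacktracking (_ , girth≤) w 1≤k nb with nonBacktracking⇒path⊎cycle w nb
  ... | inj₁ uniq              = contradiction uniq (closed⇒¬unique w 1≤k)
  ... | inj₂ (m , m≤k , cycle) = ≤-trans (girth≤ m cycle) m≤k

  closedWalkThroughEdge-nonBacktracking :
    (e : Adj x y) (u : Walk G i x s) (v : Walk G j y s) → Geodesic u →
    NonBacktracking y u → NonBacktracking x v → NonBacktracking s (reverse u ++ (e ∷ v))
  closedWalkThroughEdge-nonBacktracking e []      v _   _         nbv = (λ { refl → irrefl e }) ∷ nbv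
  closedWalkThroughEdge-nonBacktracking {s = s} e (d ∷ u) v geo (z≢y ∷ _) nbv =
    ++-nonBacktracking (reverse (d ∷ u)) (e ∷ v)
      (geodesic⇒nonBacktracking (reverse (d ∷ u)) (reverse-geodesic (d ∷ u) geo)) junction
    where
    junction : NonBacktracking (penultimate s (reverse (d ∷ u))) (e ∷ v)
    junction rewrite penultimate-∷ʳ s (reverse u) (adj-sym d) = (z≢y ∘ sym) ∷ nbv

  visibleFromEdge⇒nonBacktrackingWalk :
    {S : Subset n} → Girth G (suc (k + k)) → x ∈ S → y ∈ S → Adj x y → s ≢ x → s ≢ y →
    Visible G S k x s → Visible G S k y s → Σ (Walk G k x s) (NonBacktracking y)
  visibleFromEdge⇒nonBacktrackingWalk {k = k} {x = x} {y = y} {s = s} girth x∈S y∈S e s≢x s≢y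
    (i , i≤k , (_ , geoU) , u , avoidU) (j , j≤k , (_ , geoV) , v , avoidV) =
    subst (λ m → Σ (Walk G m x s) (NonBacktracking y)) i≡k (u , nbU)
    where
    nbU : NonBacktracking y u
    nbU = nonBacktracking-fromMember u (geodesic⇒nonBacktracking u geoU) avoidU y∈S (s≢y ∘ sym)
    nbV : NonBacktracking x v
    nbV = nonBacktracking-fromMember v (geodesic⇒nonBacktracking v geoV) avoidV x∈S (s≢x ∘ sym)
    girth≤ : suc (k + k) ≤ i + suc j
    girth≤ = girth≤closedNonBacktracking girth (reverse u ++ (e ∷ v)) (≤-trans (s≤s z≤n) (m≤n+m (suc j) i))
               (closedWalkThroughEdge-nonBacktracking e u v geoU nbU nbV)
    i≡k : i ≡ k
    i≡k = ≤-antisym i≤k (+-cancelʳ-≤ (suc k) k i (begin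
      k + suc k    ≡⟨ +-suc k k ⟩
      suc (k + k)  ≤⟨ girth≤ ⟩
      i + suc j    ≤⟨ +-monoʳ-≤ i (s≤s j≤k) ⟩
      i + suc k    ∎))
      where open ≤-Reasoning

  adj⇒∈neighbourhood : Adj a z → z ∈ neighbourhood G a
  adj⇒∈neighbourhood {a} {z} e with lookup (neighbourhood G a) z in eq
  ... | inside  = lookup⇒[]= z _ eq
  ... | outside with adj? a z | trans (sym eq) (lookup∘tabulate _ z)
  ...   | yes _  | ()
  ...   | no ¬e | _ = contradiction e ¬e

  ∈neighbourhood⇒adj : z ∈ neighbourhood G a → Adj a z
  ∈neighbourhood⇒adj {z} {a} z∈ with adj? a z | trans (sym (lookup∘tabulate _ z)) ([]=⇒lookup z∈)
  ... | yes e | _  = e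
  ... | no _  | ()

  nonBacktrackingEnds : Fin n → Fin n → ℕ → List (Fin n)
  nonBacktrackingEnds p a zero    = a ∷ []
  nonBacktrackingEnds p a (suc k) =
    concatMap (λ z → nonBacktrackingEnds a z k) (toList (neighbourhood G a - p))

  ∈-nonBacktrackingEnds : (w : Walk G k a b) → NonBacktracking p w → b ∈ₗ nonBacktrackingEnds p a k
  ∈-nonBacktrackingEnds []      []         = here refl
  ∈-nonBacktrackingEnds (e ∷ w) (z≢p ∷ nb) = ∈-concatMap⁺ _
    (lose (∈-toList⁺ (x∈p∧x≢y⇒x∈p-y (adj⇒∈neighbourhood e) z≢p)) (∈-nonBacktrackingEnds w nb))

  length-nonBacktrackingEnds : {Δ : ℕ} → (∀ v → degree G v ≤ Δ) → Adj a p → (k : ℕ) →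
                               length (nonBacktrackingEnds p a k) ≤ (Δ ∸ 1) ^ k
  length-nonBacktrackingEnds                 degree≤Δ e zero    = ≤-refl
  length-nonBacktrackingEnds {a} {p} {Δ} degree≤Δ e (suc k) = ≤-trans
    (length-concatMap-≤ _ (toList (neighbourhood G a - p)) ends≤)
    (*-monoˡ-≤ ((Δ ∸ 1) ^ k) outDegree≤Δ-1)
    where
    ends≤ : ∀ {z} → z ∈ₗ toList (neighbourhood G a - p) →
            length (nonBacktrackingEnds a z k) ≤ (Δ ∸ 1) ^ k
    ends≤ z∈ = length-nonBacktrackingEnds degree≤Δ
                 (adj-sym (∈neighbourhood⇒adj (p─q⊆p _ _ (∈-toList⁻ z∈)))) k
    outDegree≤Δ-1 : length (toList (neighbourhood G a - p)) ≤ Δ ∸ 1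
    outDegree≤Δ-1 rewrite length-toList (neighbourhood G a - p) =
      ∸-monoˡ-≤ 1 (≤-trans (x∈p⇒∣p-x∣<∣p∣ (adj⇒∈neighbourhood e)) (degree≤Δ a))

theorem5p4 : (n : ℕ) (G : Graph n) → Connected G →
    (Δ g : ℕ) → MaxDegree G Δ → 2 ≤ Δ → Girth G g → g % 2 ≡ 1 → 5 ≤ g →
    (S : Subset n) → DistMutualVisibilitySet G ((g ∸ 1) / 2) S →
    InducedHasEdge G S →
    ∣ S ∣ ≤ 2 + (Δ ∸ 1) ^ ((g ∸ 1) / 2)
theorem5p4 n G _ Δ g (degree≤Δ , _) _ girth g-odd _ S visible (x , y , x∈S , y∈S , x~y) = begin
  ∣ S ∣            ≤⟨ ∣p∣≤length S (x ∷ y ∷ ends) covered ⟩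
  2 + length ends  ≤⟨ +-monoʳ-≤ 2 (length-nonBacktrackingEnds G degree≤Δ x~y k) ⟩
  2 + (Δ ∸ 1) ^ k  ∎
  where
  open ≤-Reasoning
  k : ℕ
  k = (g ∸ 1) / 2
  ends : List (Fin n)
  ends = nonBacktrackingEnds G y x k
  covered : ∀ {s} → s ∈ S → s ∈ₗ x ∷ y ∷ ends
  covered {s} s∈S with s ≟ x | s ≟ y
  ... | yes refl | _        = here refl
  ... | no _     | yes refl = there (here refl)
  ... | no s≢x   | no s≢y   = there (there (∈-nonBacktrackingEnds G (proj₁ walk) (proj₂ walk)))
    where
    walk : Σ (Walk G k x s) (NonBacktracking G y)
    walk = visibleFromEdge⇒nonBacktrackingWalk G (subst (Girth G) (odd⇒≡1+half+half g g-odd) girth)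
             x∈S y∈S x~y s≢x s≢y (visible x s x∈S s∈S) (visible y s y∈S s∈S)
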